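{- Let $m,n\ge1$. The map $\phi:\mathsf{EW}_{m,n}\to\mathsf{LRib}_{m,n}$ described in the context is injective.
   Context: All tableaux are $0/1$ arrays; $T_{ij}$ denotes the entry in row $i$ (rows numbered top to bottom) and column $j$ (columns numbered left to right). Labels are symbols $v_0,v_1,\dots,v_{m+n-1}$, ordered by $v_i<v_j$ iff $i<j$. Rectangular EW-tableau: an $m\times n$ $0/1$ tableau $T$ such that (i) every entry of the top row is $1$; (ii) every other row contains at least one $0$; (iii) there are no rows $i\ne i'$ and columns $k\ne k'$ with $T_{ik}=T_{i'k'}=0$ and $T_{ik'}=T_{i'k}=1$. $\mathsf{EW}_{m,n}$ is the set of these. The rows of $T$ are labelled $v_0,\dots,v_{m-1}$ from top to bottom and the columns $v_m,\dots,v_{m+n-1}$ from left to right. Parallelogram polyomino of type $(m,n)$: an $m\times n$ $0/1$ tableau $P$ with $P_{11}=P_{mn}=1$, such that every row contains at least one $1$ and the $1$s in each row are contiguous, and for each $2\le i\le m$: the leftmost $1$ of row $i$ is weakly to the right of the leftmost $1$ of row $i-1$ and weakly to the left of the rightmost $1$ of row $i-1$, and the rightmost $1$ of row $i$ is weakly to the right of the rightmost $1$ of row $i-1$. It is a ribbon parallelogram polyomino if it has exactly $m+n-1$ entries equal to $1$. Labelled parallelogram polyomino of type $(m,n)$: a pair $(P,\ell)$ with $P$ a parallelogram polyomino of type $(m,n)$ and $\ell=(\ell(\mathrm{row}_1),\dots,\ell(\mathrm{row}_m),\ell(\mathrm{col}_1),\dots,\ell(\mathrm{col}_n))$, where the row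 labels are a permutation of $\{v_0,\dots,v_{m-1}\}$ with $\ell(\mathrm{row}_1)=v_0$ and such that the labels of rows whose leftmost $1$s lie in the same column are increasing from top to bottom, and the column labels are a permutation of $\{v_m,\dots,v_{m+n-1}\}$ such that the labels of columns whose topmost $1$s lie in the same row are increasing from left to right. $\mathsf{LRib}_{m,n}$ is the set of those with $P$ a ribbon parallelogram polyomino. The map $\phi$: given $T\in\mathsf{EW}_{m,n}$ with its labels, (1) permute the columns (carrying their labels) so that every entry to the left of a $0$ is a $0$, with identical columns placed so their labels increase from left to right; (2) then permute the rows (carrying labels) so that every entry above a $1$ is a $1$, with identical rows placed so their labels increase from top to bottom; call the result $T'$ and the resulting labelling $\ell$. (3) Let $R$ be the $m\times n$ tableau with $R_{ij}=1$ if either [$T'_{ij}=1$ and ($i=m$ or $T'_{i+1,j}=0$)] or [$T'_{ij}=0$ and ($j=n$ or $T'_{i,j+1}=1$)], and $R_{ij}=0$ otherwise. Set $\phi(T)=(R,\ell)$; this lies in $\mathsf{LRib}_{m,n}$. -}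

module Defs where

open import Data.Nat using (ℕ; zero; suc; _+_)
open import Data.Bool using (Bool; true; false; not; if_then_else_)
open import Data.Fin as Fin using (Fin; zero; suc; toℕ)
open import Data.Maybe using (Maybe; just; nothing; maybe)
import Data.Maybe as Maybe
open import Data.Fin.Permutation using (Permutation′; _⟨$⟩ʳ_)
open import Data.Product using (Σ; ∃; ∃-syntax; _×_; _,_)
open import Data.Empty using (⊥)
open import Relation.Binary.PropositionalEquality using (_≡_; _≢_)

-- A 0/1 tableau with m rows and n columns; entry 0 is `false`, 1 is `true`.
-- Rows/columns are indexed from 0 (Fin), top-to-bottom / left-to-right.
Tableau : ℕ → ℕ → Set
Tableau m n = Fin m → Fin n → Bool

-- Labels v_0 ,..., v_{m+n-1} are represented by Fin (m + n), v_i ↦ i;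
-- their order is the order of Fin.
Label : ℕ → ℕ → Set
Label m n = Fin (m + n)

record IsEW {m n : ℕ} (T : Tableau m n) : Set where
  field
    topRow   : ∀ (i : Fin m) → toℕ i ≡ 0 → ∀ (j : Fin n) → T i j ≡ true
    otherRow : ∀ (i : Fin m) → toℕ i ≢ 0 → ∃[ j ] T i j ≡ false
    noPattern : ∀ (i i' : Fin m) (k k' : Fin n) → i ≢ i' → k ≢ k' →
                T i k ≡ false → T i' k' ≡ false →
                T i k' ≡ true → T i' k ≡ true → ⊥

nextIdx : ∀ {k} → Fin k → Maybe (Fin k)
nextIdx {suc zero} zero = nothing
nextIdx {suc (suc k)} zero = just (suc zero)
nextIdx {suc (suc k)} (suc i) = Maybe.map suc (nextIdx i)

-- Step (3): R_ij = 1 iff [T'_ij = 1 and (i = m or T'_{i+1,j} = 0)]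
--                     or [T'_ij = 0 and (j = n or T'_{i,j+1} = 1)].
ribbonOf : ∀ {m n} → Tableau m n → Tableau m n
ribbonOf T' i j =
  if T' i j
  then maybe (λ i' → not (T' i' j)) true (nextIdx i)
  else maybe (λ j' → T' i j') true (nextIdx j)

record Labelled (m n : ℕ) : Set where
  constructor labelled
  field
    tab      : Tableau m n
    rowLabel : Fin m → Label m n
    colLabel : Fin n → Label m n

_≈L_ : ∀ {m n} → Labelled m n → Labelled m n → Set
_≈L_ {m} {n} (labelled R ρ κ) (labelled R' ρ' κ') =
  (∀ i j → R i j ≡ R' i j) × (∀ i → ρ i ≡ ρ' i) × (∀ j → κ j ≡ κ' j)

-- `IsPhi T L` : L = φ(T), i.e. L arises from T by steps (1)-(3).
-- σ : column j of the column-permuted tableau is original column σ j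
--     (carrying label v_{m + σ j});
-- τ : row i of T' is row τ i (carrying label v_{τ i}).
record IsPhi {m n : ℕ} (T : Tableau m n) (L : Labelled m n) : Set where
  open Labelled L
  field
    σ : Permutation′ n
    τ : Permutation′ m
  C : Tableau m n
  C i j = T i (σ ⟨$⟩ʳ j)
  T' : Tableau m n
  T' i j = C (τ ⟨$⟩ʳ i) j
  field
    colLabels : ∀ j → colLabel j ≡ m Fin.↑ʳ (σ ⟨$⟩ʳ j)
    rowLabels : ∀ i → rowLabel i ≡ (τ ⟨$⟩ʳ i) Fin.↑ˡ n
    leftOfZero : ∀ i (j j' : Fin n) → j' Fin.< j → C i j ≡ false → C i j' ≡ false
    identCols : ∀ (j j' : Fin n) → j Fin.< j' → (∀ i → C i j ≡ C i j') →
                colLabel j Fin.< colLabel j'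
    aboveOne : ∀ (i i' : Fin m) j → i' Fin.< i → T' i j ≡ true → T' i' j ≡ true
    identRows : ∀ (i i' : Fin m) → i Fin.< i' → (∀ j → T' i j ≡ T' i' j) →
                rowLabel i Fin.< rowLabel i'
    ribbon : ∀ i j → tab i j ≡ ribbonOf T' i j

module Submission where

open import Defs
open import Data.Nat using (ℕ; _≤_; suc; s≤s; z≤n)
open import Data.Bool using (true; false; not)
open import Data.Bool.Properties using (not-injective)
open import Data.Fin as Fin using (Fin; zero; suc; inject₁)
open import Data.Fin.Induction using (<-weakInduction)
open import Data.Fin.Properties using (↑ˡ-injective; ↑ʳ-injective; ≤̄⇒inject₁<; ≤-refl)
open import Data.Fin.Permutation using (_⟨$⟩ʳ_; _⟨$⟩ˡ_; inverseʳ)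
open import Data.Maybe using (just)
open import Data.Product using (_,_)
open import Relation.Binary.PropositionalEquality
  using (_≡_; refl; sym; trans; cong₂; subst; module ≡-Reasoning)

-- The labels of φ(T) record the row and column permutations that sort T, so it
-- suffices to recover the sorted tableau T' from R. Every column of T' is a run of
-- 1s above a run of 0s and its top row is full (it contains the top row of T);
-- going down a column, R has a 1 at a 1 of T' exactly at the last 1, so each row
-- of T' is determined by the row above it.

OnesOnTop : ∀ {m n} → Tableau m n → Set
OnesOnTop {m} S = ∀ (i i' : Fin m) j → i' Fin.< i → S i j ≡ true → S i' j ≡ true

onesOnTop-zero : ∀ {k n} {S : Tableau (suc k) n} → OnesOnTop S →
                 ∀ i j → S i j ≡ true → S zero j ≡ true
onesOnTop-zero up zero    j Sij = Sij
onesOnTop-zero up (suc i) j Sij = up (suc i) zero j (s≤s z≤n) Sij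

onesOnTop-suc : ∀ {k n} {S : Tableau (suc k) n} → OnesOnTop S →
                ∀ (i : Fin k) j → S (inject₁ i) j ≡ false → S (suc i) j ≡ false
onesOnTop-suc {S = S} up i j S↑ij with S (suc i) j in S₊ij
... | false = refl
... | true  with () ← trans (sym (up (suc i) (inject₁ i) j (≤̄⇒inject₁< ≤-refl) S₊ij)) S↑ij

nextIdx-inject₁ : ∀ {k} (i : Fin k) → nextIdx (inject₁ i) ≡ just (suc i)
nextIdx-inject₁ {suc _}       zero    = refl
nextIdx-inject₁ {suc (suc _)} (suc i) rewrite nextIdx-inject₁ i = refl

ribbonOf-one : ∀ {k n} (S : Tableau (suc k) n) (i : Fin k) j → S (inject₁ i) j ≡ true →
               ribbonOf S (inject₁ i) j ≡ not (S (suc i) j)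
ribbonOf-one S i j S↑ij rewrite S↑ij | nextIdx-inject₁ i = refl

ribbonOf-injective : ∀ {k n} (S₁ S₂ : Tableau (suc k) n) →
                     (∀ j → S₁ zero j ≡ true) → (∀ j → S₂ zero j ≡ true) →
                     OnesOnTop S₁ → OnesOnTop S₂ →
                     (∀ i j → ribbonOf S₁ i j ≡ ribbonOf S₂ i j) →
                     ∀ i j → S₁ i j ≡ S₂ i j
ribbonOf-injective S₁ S₂ top₁ top₂ up₁ up₂ sameRibbon =
  <-weakInduction (λ i → ∀ j → S₁ i j ≡ S₂ i j) (λ j → trans (top₁ j) (sym (top₂ j))) nextRow
  where
  open ≡-Reasoning
  nextRow : ∀ i → (∀ j → S₁ (inject₁ i) j ≡ S₂ (inject₁ i) j) →
            ∀ j → S₁ (suc i) j ≡ S₂ (suc i) j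
  nextRow i sameRow j with S₁ (inject₁ i) j in S₁↑ij
  ... | true  = not-injective (begin
        not (S₁ (suc i) j)         ≡⟨ sym (ribbonOf-one S₁ i j S₁↑ij) ⟩
        ribbonOf S₁ (inject₁ i) j  ≡⟨ sameRibbon (inject₁ i) j ⟩
        ribbonOf S₂ (inject₁ i) j  ≡⟨ ribbonOf-one S₂ i j (trans (sym (sameRow j)) S₁↑ij) ⟩
        not (S₂ (suc i) j)         ∎)
  ... | false = trans (onesOnTop-suc up₁ i j S₁↑ij)
                      (sym (onesOnTop-suc up₂ i j (trans (sym (sameRow j)) S₁↑ij)))

module _ {m n : ℕ} {T₁ T₂ : Tableau m n} {L₁ L₂ : Labelled m n}
         (φ₁ : IsPhi T₁ L₁) (φ₂ : IsPhi T₂ L₂) where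
  private
    module P₁ = IsPhi φ₁
    module P₂ = IsPhi φ₂

  rowPerm-determined : (∀ i → Labelled.rowLabel L₁ i ≡ Labelled.rowLabel L₂ i) →
                       ∀ i → P₁.τ ⟨$⟩ʳ i ≡ P₂.τ ⟨$⟩ʳ i
  rowPerm-determined sameLabels i =
    ↑ˡ-injective n _ _ (trans (sym (P₁.rowLabels i)) (trans (sameLabels i) (P₂.rowLabels i)))

  colPerm-determined : (∀ j → Labelled.colLabel L₁ j ≡ Labelled.colLabel L₂ j) →
                       ∀ j → P₁.σ ⟨$⟩ʳ j ≡ P₂.σ ⟨$⟩ʳ j
  colPerm-determined sameLabels j =
    ↑ʳ-injective m _ _ (trans (sym (P₁.colLabels j)) (trans (sameLabels j) (P₂.colLabels j)))

sorted-topRow : ∀ {k n} {T : Tableau (suc k) n} {L} → IsEW T → (φ : IsPhi T L) →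
                ∀ j → IsPhi.T' φ zero j ≡ true
sorted-topRow {T = T} ew φ j =
  onesOnTop-zero aboveOne (τ ⟨$⟩ˡ zero) j
    (subst (λ r → T r (σ ⟨$⟩ʳ j) ≡ true) (sym (inverseʳ τ)) (IsEW.topRow ew zero refl _))
  where open IsPhi φ

theorem3p5 : (m n : ℕ) → 1 ≤ m → 1 ≤ n →
    (T₁ T₂ : Tableau m n) → IsEW T₁ → IsEW T₂ →
    (L₁ L₂ : Labelled m n) → IsPhi T₁ L₁ → IsPhi T₂ L₂ →
    L₁ ≈L L₂ → ∀ i j → T₁ i j ≡ T₂ i j
theorem3p5 (suc k) n _ _ T₁ T₂ ew₁ ew₂ L₁ L₂ φ₁ φ₂ (sameTab , sameRows , sameCols) i j =
  begin
    T₁ i j                            ≡⟨ cong₂ T₁ (sym (inverseʳ P₁.τ)) (sym (inverseʳ P₁.σ)) ⟩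
    T₁ (P₁.τ ⟨$⟩ʳ i') (P₁.σ ⟨$⟩ʳ j')  ≡⟨ sameSorted i' j' ⟩
    T₂ (P₂.τ ⟨$⟩ʳ i') (P₂.σ ⟨$⟩ʳ j')  ≡⟨ cong₂ T₂ (sym (rowPerm-determined φ₁ φ₂ sameRows i'))
                                                     (sym (colPerm-determined φ₁ φ₂ sameCols j')) ⟩
    T₂ (P₁.τ ⟨$⟩ʳ i') (P₁.σ ⟨$⟩ʳ j')  ≡⟨ cong₂ T₂ (inverseʳ P₁.τ) (inverseʳ P₁.σ) ⟩
    T₂ i j                            ∎
  where
  open ≡-Reasoning
  module P₁ = IsPhi φ₁
  module P₂ = IsPhi φ₂
  i' : Fin (suc k)
  i' = P₁.τ ⟨$⟩ˡ i
  j' : Fin n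
  j' = P₁.σ ⟨$⟩ˡ j
  sameSorted : ∀ r c → P₁.T' r c ≡ P₂.T' r c
  sameSorted = ribbonOf-injective P₁.T' P₂.T' (sorted-topRow ew₁ φ₁) (sorted-topRow ew₂ φ₂)
                 P₁.aboveOne P₂.aboveOne
                 (λ r c → trans (sym (P₁.ribbon r c)) (trans (sameTab r c) (P₂.ribbon r c)))
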